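{- The saturation of a finite sample set is finite.
   Context: Terms are built from a countably infinite set of variables using $\wedge,\vee,\cdot,{}',1$; a term is basic if it is built using only variables, $\cdot$ (binary), ${}'$ (unary) and $1$. Fix a countably infinite set of time variables $\kappa$, disjoint from the term variables. Samples are the purely syntactic expressions generated by the grammar $\alpha::=\kappa\mid t[\alpha]\mid\mathrm{suc}(\alpha)\mid\mathrm{last}(t)$, where $t$ ranges over basic terms and $\kappa$ over time variables. Let $\leadsto$ be the binary relation on samples given, for all basic terms $t,u$ and samples $\alpha$, by: $t[\alpha]\leadsto\alpha$; $(t\cdot u)[\alpha]\leadsto t[u[\alpha]]$; $\mathrm{suc}(\alpha)\leadsto\alpha$; $t'[\alpha]\leadsto t[t'[\alpha]]$; $t[\alpha]\leadsto t[\mathrm{last}(t)]$; $t'[\alpha]\leadsto t[\mathrm{suc}(t'[\alpha])]$. The saturation of a set $\Delta$ of samples is $\{\beta\mid \alpha\leadsto^*\beta \text{ for some }\alpha\in\Delta\}$, where $\leadsto^*$ is the reflexive transitive closure of $\leadsto$. -}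

module Defs where

open import Data.Nat using (ℕ)
open import Data.List using (List)
open import Data.List.Membership.Propositional using (_∈_)
open import Data.Product using (Σ; ∃; _×_)
open import Relation.Binary.Construct.Closure.ReflexiveTransitive using (Star)

data BTerm : Set where
  var  : ℕ → BTerm
  _·_  : BTerm → BTerm → BTerm
  _′   : BTerm → BTerm
  one  : BTerm

-- Samples: α ::= κ | t[α] | suc(α) | last(t); time variables indexed by ℕ,
-- disjoint from term variables (they live in a separate syntactic sort).
data Sample : Set where
  tvar  : ℕ → Sample
  _[_]  : BTerm → Sample → Sample
  sucS  : Sample → Sample
  last  : BTerm → Sample

data _↝_ : Sample → Sample → Set where
  r-app   : ∀ t α → (t [ α ]) ↝ α
  r-dot   : ∀ t u α → ((t · u) [ α ]) ↝ (t [ u [ α ] ])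
  r-suc   : ∀ α → sucS α ↝ α
  r-prime : ∀ t α → ((t ′) [ α ]) ↝ (t [ (t ′) [ α ] ])
  r-last  : ∀ t α → (t [ α ]) ↝ (t [ last t ])
  r-psuc  : ∀ t α → ((t ′) [ α ]) ↝ (t [ sucS ((t ′) [ α ]) ])

_↝*_ : Sample → Sample → Set
_↝*_ = Star _↝_

Saturation : List Sample → Sample → Set
Saturation Δ β = ∃ λ α → α ∈ Δ × α ↝* β

FiniteSet : (Sample → Set) → Set
FiniteSet P = Σ (List Sample) λ L → ∀ β → P β → β ∈ L

-- Every step out of t[x] either returns to x, replaces x by last(t), or applies a
-- proper subterm of t to an argument built from x and t by t[-] and suc. Hence, by
-- recursion on t, whatever is reachable from the applications t[x], x ∈ C, lies in
-- a finite set appClosure t C or is reachable from C itself; recursion on α then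
-- gives a finite ↝-closed set containing α.
module Submission where

open import Defs
open import Data.List using (List; []; _∷_; _++_; map; concatMap)
open import Data.List.Membership.Propositional using (_∈_)
open import Data.List.Membership.Propositional.Properties
  using (∈-++⁺ˡ; ∈-++⁺ʳ; ∈-++⁻; ∈-map⁺; ∈-map⁻; ∈-concat⁺′)
open import Data.List.Relation.Binary.Subset.Propositional using (_⊆_)
open import Data.List.Relation.Binary.Subset.Propositional.Properties
  using (⊆-refl; ⊆-trans; xs⊆xs++ys; xs⊆ys++xs; ++⁺ˡ)
open import Data.List.Relation.Unary.Any using (here; there)
open import Data.Product using (_,_)
open import Data.Sum using ([_,_])
open import Function using (_∘_)
open import Relation.Binary.PropositionalEquality using (refl)
open import Relation.Binary.Construct.Closure.ReflexiveTransitive using (ε; _◅_)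

⊆-++-merge : {A : Set} {xs ys zs : List A} → xs ⊆ zs → ys ⊆ zs → xs ++ ys ⊆ zs
⊆-++-merge {xs = xs} xs⊆zs ys⊆zs = [ xs⊆zs , ys⊆zs ] ∘ ∈-++⁻ xs

SuccessorsIn : List Sample → List Sample → Set
SuccessorsIn L M = ∀ {β γ} → β ∈ L → β ↝ γ → γ ∈ M

Closed : List Sample → Set
Closed L = SuccessorsIn L L

successorsIn-++ : {L L′ M : List Sample} →
                  SuccessorsIn L M → SuccessorsIn L′ M → SuccessorsIn (L ++ L′) M
successorsIn-++ {L} L↝M L′↝M β∈ = [ L↝M , L′↝M ] (∈-++⁻ L β∈)

successorsIn-⊆ : {L M M′ : List Sample} → M ⊆ M′ → SuccessorsIn L M → SuccessorsIn L M′
successorsIn-⊆ M⊆M′ L↝M β∈ s = M⊆M′ (L↝M β∈ s)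

closed-↝* : {L : List Sample} {β γ : Sample} → Closed L → β ∈ L → β ↝* γ → γ ∈ L
closed-↝* L-closed β∈ ε = β∈
closed-↝* L-closed β∈ (s ◅ ss) = closed-↝* L-closed (L-closed β∈ s) ss

args : BTerm → List Sample → List Sample
args t C = last t ∷ C

args-successors : ∀ t {C M} → SuccessorsIn C M → SuccessorsIn (args t C) M
args-successors t C↝M (here refl) ()
args-successors t C↝M (there β∈) s = C↝M β∈ s

-- r-prime and r-psuc apply a to the samples a′[x] and suc(a′[x]).
primeArgs : BTerm → List Sample → List Sample
primeArgs a A = map ((a ′) [_]) A ++ map (sucS ∘ ((a ′) [_])) A ++ A

prime∈primeArgs : ∀ a {A x} → x ∈ A → ((a ′) [ x ]) ∈ primeArgs a A
prime∈primeArgs a x∈ = ∈-++⁺ˡ (∈-map⁺ ((a ′) [_]) x∈)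

sucPrime∈primeArgs : ∀ a {A x} → x ∈ A → sucS ((a ′) [ x ]) ∈ primeArgs a A
sucPrime∈primeArgs a {A} x∈ =
  ∈-++⁺ʳ (map ((a ′) [_]) A) (∈-++⁺ˡ (∈-map⁺ (sucS ∘ ((a ′) [_])) x∈))

mutual
  appClosure : BTerm → List Sample → List Sample
  appClosure t C = args t C ++ map (t [_]) (args t C) ++ unfold t (args t C)

  unfold : BTerm → List Sample → List Sample
  unfold (var n) A = []
  unfold one A = []
  unfold (a · b) A = appClosure a (appClosure b A)
  unfold (a ′) A = appClosure a (primeArgs a A)

args⊆appClosure : ∀ t C → args t C ⊆ appClosure t C
args⊆appClosure t C = xs⊆xs++ys _ _

⊆-appClosure : ∀ t C → C ⊆ appClosure t C
⊆-appClosure t C = args⊆appClosure t C ∘ there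

app∈appClosure : ∀ t C {x} → x ∈ args t C → (t [ x ]) ∈ appClosure t C
app∈appClosure t C x∈ = ∈-++⁺ʳ (args t C) (∈-++⁺ˡ (∈-map⁺ (t [_]) x∈))

unfold⊆appClosure : ∀ t C → unfold t (args t C) ⊆ appClosure t C
unfold⊆appClosure t C = ∈-++⁺ʳ (args t C) ∘ ∈-++⁺ʳ (map (t [_]) (args t C))

app-successors : ∀ t C {x γ} → x ∈ args t C → (t [ x ]) ↝ γ → γ ∈ appClosure t C
app-successors t C x∈ (r-app _ _) = args⊆appClosure t C x∈
app-successors t C x∈ (r-last _ _) = app∈appClosure t C (here refl)
app-successors (a · b) C x∈ (r-dot _ _ _) =
  unfold⊆appClosure (a · b) C
    (app∈appClosure a _ (there (app∈appClosure b _ (there x∈))))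
app-successors (a ′) C x∈ (r-prime _ _) =
  unfold⊆appClosure (a ′) C (app∈appClosure a _ (there (prime∈primeArgs a x∈)))
app-successors (a ′) C x∈ (r-psuc _ _) =
  unfold⊆appClosure (a ′) C (app∈appClosure a _ (there (sucPrime∈primeArgs a x∈)))

apps-successors : ∀ t C → SuccessorsIn (map (t [_]) (args t C)) (appClosure t C)
apps-successors t C β∈ s with x , x∈ , refl ← ∈-map⁻ (t [_]) β∈ =
  app-successors t C x∈ s

sucApps-successors : ∀ a C →
                     SuccessorsIn (map (sucS ∘ ((a ′) [_])) (args (a ′) C)) (appClosure (a ′) C)
sucApps-successors a C β∈ s with ∈-map⁻ (sucS ∘ ((a ′) [_])) β∈
sucApps-successors a C β∈ (r-suc _) | x , x∈ , refl = app∈appClosure (a ′) C x∈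

mutual
  appClosure-successors : ∀ t {C M} → SuccessorsIn C M →
                          SuccessorsIn (appClosure t C) (appClosure t C ++ M)
  appClosure-successors t {C} C↝M =
    successorsIn-++ (successorsIn-⊆ (xs⊆ys++xs _ _) (args-successors t C↝M))
      (successorsIn-++ (successorsIn-⊆ (xs⊆xs++ys _ _) (apps-successors t C))
        (unfold-successors t C↝M))

  unfold-successors : ∀ t {C M} → SuccessorsIn C M →
                      SuccessorsIn (unfold t (args t C)) (appClosure t C ++ M)
  unfold-successors (var n) C↝M ()
  unfold-successors one C↝M ()
  unfold-successors (a · b) {C} {M} C↝M =
    successorsIn-⊆
      (⊆-++-merge (⊆-trans U (xs⊆xs++ys _ _)) (++⁺ˡ M (⊆-trans (⊆-appClosure a _) U)))
      (appClosure-successors a (appClosure-successors b (args-successors (a · b) C↝M)))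
    where U = unfold⊆appClosure (a · b) C
  unfold-successors (a ′) {C} {M} C↝M =
    successorsIn-⊆
      (⊆-++-merge (⊆-trans (unfold⊆appClosure (a ′) C) (xs⊆xs++ys _ _)) ⊆-refl)
      (appClosure-successors a primeArgs-successors)
    where
    primeArgs-successors : SuccessorsIn (primeArgs a (args (a ′) C)) (appClosure (a ′) C ++ M)
    primeArgs-successors =
      successorsIn-++ (successorsIn-⊆ (xs⊆xs++ys _ _) (apps-successors (a ′) C))
        (successorsIn-++ (successorsIn-⊆ (xs⊆xs++ys _ _) (sucApps-successors a C))
          (successorsIn-⊆ (xs⊆ys++xs _ _) (args-successors (a ′) C↝M)))

closure : Sample → List Sample
closure (tvar n) = tvar n ∷ []
closure (last t) = last t ∷ []
closure (sucS α) = sucS α ∷ closure α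
closure (t [ α ]) = appClosure t (closure α)

∈-closure : ∀ α → α ∈ closure α
∈-closure (tvar n) = here refl
∈-closure (last t) = here refl
∈-closure (sucS α) = here refl
∈-closure (t [ α ]) = app∈appClosure t (closure α) (there (∈-closure α))

closure-closed : ∀ α → Closed (closure α)
closure-closed (tvar n) (here refl) ()
closure-closed (last t) (here refl) ()
closure-closed (sucS α) (here refl) (r-suc _) = there (∈-closure α)
closure-closed (sucS α) (there β∈) s = there (closure-closed α β∈ s)
closure-closed (t [ α ]) =
  successorsIn-⊆ (⊆-++-merge ⊆-refl (⊆-appClosure t (closure α)))
    (appClosure-successors t (closure-closed α))

lemma3p2 : (Δ : List Sample) → FiniteSet (Saturation Δ)
lemma3p2 Δ = concatMap closure Δ , λ β (α , α∈Δ , α↝*β) →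
  ∈-concat⁺′ (closed-↝* (closure-closed α) (∈-closure α) α↝*β) (∈-map⁺ closure α∈Δ)
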